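{- (Soundness of $\mathbf{FRJ}(G)$.) For every propositional formula $G$: if $G$ is provable in $\mathbf{FRJ}(G)$, i.e. there is a set $\Gamma$ such that the regular sequent $\Gamma\Rightarrow G$ is derivable in $\mathbf{FRJ}(G)$, then $G$ is not valid in intuitionistic propositional logic ($G\notin\mathrm{IPL}$). This holds for the calculus $\mathbf{FRJ}(G)$ as given by the rules below, without imposing the additional restrictions (R1)–(R4).
   Context: Formulas are built from a countably infinite set $\mathcal{V}$ of propositional variables and the constant $\bot$ using $\land,\lor,\supset$; $\neg A$ abbreviates $A\supset\bot$. Let $\mathcal{V}_\bot=\mathcal{V}\cup\{\bot\}$ and let $\mathcal{L}^{\supset}$ be the set of formulas with main connective $\supset$. For a formula $G$, the sets $\mathrm{Sl}(G)$ and $\mathrm{Sr}(G)$ of left and right subformulas are the smallest subsets of the set of subformulas of $G$ such that: $G\in\mathrm{Sr}(G)$; if $A\land B$ or $A\lor B$ belongs to $\mathrm{Sl}(G)$ (resp. $\mathrm{Sr}(G)$) then $A,B$ belong to $\mathrm{Sl}(G)$ (resp. $\mathrm{Sr}(G)$); if $A\supset B\in\mathrm{Sl}(G)$ then $B\in\mathrm{Sl}(G)$ and $A\in\mathrm{Sr}(G)$; if $A\supset B\in\mathrm{Sr}(G)$ then $B\in\mathrm{Sr}(G)$ and $A\in\mathrm{Sl}(G)$. The closure $\mathrm{Cl}(\Gamma)$ of a set of formulas $\Gamma$ is the smallest set containing $\Gamma$ such that whenever $X,Y\in\mathrm{Cl}(\Gamma)$ and $A$ is an arbitrary formula, $X\land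 Y$, $A\lor X$, $X\lor A$, $A\supset X\in\mathrm{Cl}(\Gamma)$. Let $\bar\Gamma^{At}=\mathrm{Sl}(G)\cap\mathcal{V}$, $\bar\Gamma^{\supset}=\mathrm{Sl}(G)\cap\mathcal{L}^{\supset}$, $\bar\Gamma=\bar\Gamma^{At}\cup\bar\Gamma^{\supset}$. $\mathbf{FRJ}(G)$-sequents are regular sequents $\Gamma\Rightarrow C$ with $\Gamma\subseteq\bar\Gamma$, $C\in\mathrm{Sr}(G)$, and irregular sequents $\Sigma;\Theta\rightarrow C$ with $\Sigma\cup\Theta\subseteq\bar\Gamma$, $C\in\mathrm{Sr}(G)$. Commas in sets denote union. In every rule the right formula of the conclusion belongs to $\mathrm{Sr}(G)$. Rules ($F\in\mathcal{V}_\bot$, $k\in\{1,2\}$): (Ax$_\Rightarrow$) axiom $\bar\Gamma^{At}\setminus\{F\}\Rightarrow F$. (Ax$_\rightarrow$) axiom $\emptyset;(\bar\Gamma^{At}\setminus\{F\})\cup\bar\Gamma^{\supset}\rightarrow F$. ($\land$) from $\Gamma\Rightarrow A_k$ infer $\Gamma\Rightarrow A_1\land A_2$; from $\Sigma;\Theta\rightarrow A_k$ infer $\Sigma;\Theta\rightarrow A_1\land A_2$. ($\lor$) from $\Sigma_1;\Theta_1\rightarrow C_1$ and $\Sigma_2;\Theta_2\rightarrow C_2$ infer $\Sigma_1\cup\Sigma_2;\Theta_1\cap\Theta_2\rightarrow C_1\lor C_2$, provided $\Sigma_1\subseteq\Sigma_2\cup\Theta_2$ and $\Sigma_2\subseteq\Sigma_1\cup\Theta_1$.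 ($\supset_\in$) from $\Gamma\Rightarrow B$ infer $\Gamma\Rightarrow A\supset B$ provided $A\in\mathrm{Cl}(\Gamma)$; from $\Sigma;\Theta\cup\Lambda\rightarrow B$ with $\Theta\cap\Lambda=\emptyset$ infer $\Sigma\cup\Lambda;\Theta\rightarrow A\supset B$ provided $A\in\mathrm{Cl}(\Sigma\cup\Lambda)$. ($\supset_{\notin}$) from $\Gamma\Rightarrow B$ infer $\emptyset;\Theta\rightarrow A\supset B$ provided $\Theta\subseteq\mathrm{Cl}(\Gamma)\cap\bar\Gamma$ and $A\in\mathrm{Cl}(\Gamma)\setminus\mathrm{Cl}(\Theta)$. (Join rules) premises $\Sigma_j;\Theta_j\rightarrow A_j$ for $1\le j\le n$, $n\ge1$. Let $\Upsilon=\{A_1,\dots,A_n\}$, $\Sigma^{At}=\bigcup_j(\Sigma_j\cap\mathcal V)$, $\Sigma^{\supset}=\bigcup_j(\Sigma_j\cap\mathcal L^{\supset})$, $\Theta^{At}=\bigcap_j(\Theta_j\cap\mathcal V)$, $\Theta^{\supset}=\{Y\supset Z\in\bigcap_j(\Theta_j\cap\mathcal L^{\supset}) : Y\in\Upsilon\}$. Side conditions for both: (J1) $\Sigma_i\subseteq\Sigma_j\cup\Theta_j$ for all $i\neq j$; (J2) $Y\supset Z\in\Sigma^{\supset}$ implies $Y\in\Upsilon$. ($\bowtie^{At}$) conclusion $\Sigma^{At}\cup(\Theta^{At}\setminus\{F\})\cup\Sigma^{\supset}\cup\Theta^{\supset}\Rightarrow F$ with $F\in\mathcal V_\bot\setminus\Sigma^{At}$.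 ($\bowtie^{\lor}$) conclusion $\Sigma^{At}\cup\Theta^{At}\cup\Sigma^{\supset}\cup\Theta^{\supset}\Rightarrow C_1\lor C_2$ with $\{C_1,C_2\}\subseteq\Upsilon$. (The restrictions (R1)–(R4), not imposed here, are: minimality of $\Lambda$ in irregular $\supset_\in$; maximality of $\Theta$ in $\supset_{\notin}$; and conditions on $\Upsilon$ in the join rules.) A derivation is a finite tree of sequents built by these rules with axioms at the leaves. Kripke models, forcing and $\mathrm{IPL}$ (the set of formulas forced at the root of every finite rooted Kripke model) are standard. -}

module Defs where

open import Level using (0ℓ)
open import Data.Nat using (ℕ; suc)
open import Data.Fin using (Fin)
open import Data.Product using (Σ; Σ-syntax; ∃; ∃-syntax; _×_; _,_)
open import Data.Sum using (_⊎_)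
open import Data.Empty renaming (⊥ to Empty)
open import Relation.Nullary using (¬_)
open import Relation.Unary using (Pred; _∈_; _∉_; _⊆_; _≐_)
open import Relation.Binary.PropositionalEquality using (_≡_; _≢_)
open import Relation.Binary.Structures using (IsPartialOrder)

infixr 6 _∧_
infixr 5 _∨_
infixr 4 _⊃_

data Formula : Set where
  var : ℕ → Formula
  ⊥'  : Formula
  _∧_ : Formula → Formula → Formula
  _∨_ : Formula → Formula → Formula
  _⊃_ : Formula → Formula → Formula

FSet : Set₁
FSet = Pred Formula 0ℓ

IsVar : FSet
IsVar X = ∃[ n ] X ≡ var n

IsVar⊥ : FSet
IsVar⊥ X = IsVar X ⊎ X ≡ ⊥'

IsImp : FSet
IsImp X = ∃[ A ] ∃[ B ] X ≡ (A ⊃ B)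

_∪'_ : FSet → FSet → FSet
(P ∪' Q) X = P X ⊎ Q X

_∩'_ : FSet → FSet → FSet
(P ∩' Q) X = P X × Q X

_minus_ : FSet → Formula → FSet
(P minus F) X = P X × X ≢ F

∅' : FSet
∅' X = Empty

Disjoint : FSet → FSet → Set
Disjoint P Q = ∀ X → P X → Q X → Empty

infixl 7 _∩'_
infixl 6 _∪'_

mutual
  data Sl (G : Formula) : FSet where
    ∧l₁ : ∀ {A B} → Sl G (A ∧ B) → Sl G A
    ∧l₂ : ∀ {A B} → Sl G (A ∧ B) → Sl G B
    ∨l₁ : ∀ {A B} → Sl G (A ∨ B) → Sl G A
    ∨l₂ : ∀ {A B} → Sl G (A ∨ B) → Sl G B
    ⊃l  : ∀ {A B} → Sl G (A ⊃ B) → Sl G B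
    ⊃rl : ∀ {A B} → Sr G (A ⊃ B) → Sl G A

  data Sr (G : Formula) : FSet where
    root : Sr G G
    ∧r₁ : ∀ {A B} → Sr G (A ∧ B) → Sr G A
    ∧r₂ : ∀ {A B} → Sr G (A ∧ B) → Sr G B
    ∨r₁ : ∀ {A B} → Sr G (A ∨ B) → Sr G A
    ∨r₂ : ∀ {A B} → Sr G (A ∨ B) → Sr G B
    ⊃r  : ∀ {A B} → Sr G (A ⊃ B) → Sr G B
    ⊃lr : ∀ {A B} → Sl G (A ⊃ B) → Sr G A

data Cl (Γ : FSet) : FSet where
  base : ∀ {X} → X ∈ Γ → Cl Γ X
  cl∧  : ∀ {X Y} → Cl Γ X → Cl Γ Y → Cl Γ (X ∧ Y)
  cl∨ˡ : ∀ {X} A → Cl Γ X → Cl Γ (A ∨ X)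
  cl∨ʳ : ∀ {X} A → Cl Γ X → Cl Γ (X ∨ A)
  cl⊃  : ∀ {X} A → Cl Γ X → Cl Γ (A ⊃ X)

module FRJ (G : Formula) where

  ΓAt : FSet
  ΓAt = Sl G ∩' IsVar

  Γ⊃ : FSet
  Γ⊃ = Sl G ∩' IsImp

  Γbar : FSet
  Γbar = ΓAt ∪' Γ⊃

  -- Join-rule data: premises Σ_j;Θ_j → A_j for j : Fin n, n ≥ 1
  module Join {n : ℕ} (Σs Θs : Fin n → FSet) (As : Fin n → Formula) where

    Υ : FSet
    Υ X = ∃[ j ] As j ≡ X

    ΣAt : FSet
    ΣAt X = IsVar X × ∃[ j ] Σs j X

    Σ⊃ : FSet
    Σ⊃ X = IsImp X × ∃[ j ] Σs j X

    ΘAt : FSet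
    ΘAt X = IsVar X × (∀ j → Θs j X)

    Θ⊃ : FSet
    Θ⊃ X = ∃[ Y ] ∃[ Z ] (X ≡ (Y ⊃ Z) × (∀ j → Θs j X) × Υ Y)

    J1 : Set
    J1 = ∀ i j → i ≢ j → Σs i ⊆ (Σs j ∪' Θs j)

    J2 : Set
    J2 = ∀ Y Z → (Y ⊃ Z) ∈ Σ⊃ → Y ∈ Υ

  -- Reg Γ C  : the regular sequent Γ ⇒ C is derivable
  -- Irr Σ Θ C : the irregular sequent Σ;Θ → C is derivable
  -- Every constructor requires its conclusion to be an FRJ(G)-sequent
  -- (antecedent sets ⊆ Γ̄, right formula ∈ Sr(G)).
  mutual
    data Reg (Γ : FSet) : Formula → Set₁ where
      ax⇒ : ∀ {F} → F ∈ IsVar⊥ → F ∈ Sr G → Γ ⊆ Γbar →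
            Γ ≐ (ΓAt minus F) → Reg Γ F
      ∧₁⇒ : ∀ {A₁ A₂} → (A₁ ∧ A₂) ∈ Sr G → Γ ⊆ Γbar →
            Reg Γ A₁ → Reg Γ (A₁ ∧ A₂)
      ∧₂⇒ : ∀ {A₁ A₂} → (A₁ ∧ A₂) ∈ Sr G → Γ ⊆ Γbar →
            Reg Γ A₂ → Reg Γ (A₁ ∧ A₂)
      ⊃∈⇒ : ∀ {A B} → (A ⊃ B) ∈ Sr G → Γ ⊆ Γbar →
            Reg Γ B → A ∈ Cl Γ → Reg Γ (A ⊃ B)
      ⋈At : ∀ {m F} (Σs Θs : Fin (suc m) → FSet) (As : Fin (suc m) → Formula) →
            (∀ j → Irr (Σs j) (Θs j) (As j)) →
            Join.J1 Σs Θs As → Join.J2 Σs Θs As →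
            F ∈ IsVar⊥ → F ∉ Join.ΣAt Σs Θs As →
            F ∈ Sr G → Γ ⊆ Γbar →
            Γ ≐ (Join.ΣAt Σs Θs As ∪' (Join.ΘAt Σs Θs As minus F)
                 ∪' Join.Σ⊃ Σs Θs As ∪' Join.Θ⊃ Σs Θs As) →
            Reg Γ F
      ⋈∨  : ∀ {m C₁ C₂} (Σs Θs : Fin (suc m) → FSet) (As : Fin (suc m) → Formula) →
            (∀ j → Irr (Σs j) (Θs j) (As j)) →
            Join.J1 Σs Θs As → Join.J2 Σs Θs As →
            C₁ ∈ Join.Υ Σs Θs As → C₂ ∈ Join.Υ Σs Θs As →
            (C₁ ∨ C₂) ∈ Sr G → Γ ⊆ Γbar →
            Γ ≐ (Join.ΣAt Σs Θs As ∪' Join.ΘAt Σs Θs As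
                 ∪' Join.Σ⊃ Σs Θs As ∪' Join.Θ⊃ Σs Θs As) →
            Reg Γ (C₁ ∨ C₂)

    data Irr (Σ' Θ : FSet) : Formula → Set₁ where
      ax→ : ∀ {F} → F ∈ IsVar⊥ → F ∈ Sr G → Σ' ⊆ Γbar → Θ ⊆ Γbar →
            Σ' ≐ ∅' → Θ ≐ ((ΓAt minus F) ∪' Γ⊃) → Irr Σ' Θ F
      ∧₁→ : ∀ {A₁ A₂} → (A₁ ∧ A₂) ∈ Sr G → Σ' ⊆ Γbar → Θ ⊆ Γbar →
            Irr Σ' Θ A₁ → Irr Σ' Θ (A₁ ∧ A₂)
      ∧₂→ : ∀ {A₁ A₂} → (A₁ ∧ A₂) ∈ Sr G → Σ' ⊆ Γbar → Θ ⊆ Γbar →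
            Irr Σ' Θ A₂ → Irr Σ' Θ (A₁ ∧ A₂)
      ∨→  : ∀ {Σ₁ Θ₁ Σ₂ Θ₂ C₁ C₂} → (C₁ ∨ C₂) ∈ Sr G → Σ' ⊆ Γbar → Θ ⊆ Γbar →
            Irr Σ₁ Θ₁ C₁ → Irr Σ₂ Θ₂ C₂ →
            Σ₁ ⊆ (Σ₂ ∪' Θ₂) → Σ₂ ⊆ (Σ₁ ∪' Θ₁) →
            Σ' ≐ (Σ₁ ∪' Σ₂) → Θ ≐ (Θ₁ ∩' Θ₂) → Irr Σ' Θ (C₁ ∨ C₂)
      ⊃∈→ : ∀ {Σ₀ Ξ Λ A B} → (A ⊃ B) ∈ Sr G → Σ' ⊆ Γbar → Θ ⊆ Γbar →
            Irr Σ₀ Ξ B → Ξ ≐ (Θ ∪' Λ) → Disjoint Θ Λ →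
            Σ' ≐ (Σ₀ ∪' Λ) → A ∈ Cl (Σ₀ ∪' Λ) → Irr Σ' Θ (A ⊃ B)
      ⊃∉→ : ∀ {Γ A B} → (A ⊃ B) ∈ Sr G → Σ' ⊆ Γbar → Θ ⊆ Γbar →
            Reg Γ B → Σ' ≐ ∅' → Θ ⊆ (Cl Γ ∩' Γbar) →
            A ∈ Cl Γ → A ∉ Cl Θ → Irr Σ' Θ (A ⊃ B)

Provable : Formula → Set₁
Provable G = Σ[ Γ ∈ FSet ] FRJ.Reg G Γ G

record KripkeModel : Set₁ where
  field
    size    : ℕ
    _≤_     : Fin size → Fin size → Set
    isPO    : IsPartialOrder _≡_ _≤_
    r       : Fin size
    r-least : ∀ w → r ≤ w
    V       : Fin size → ℕ → Set
    V-mono  : ∀ {w w′} p → w ≤ w′ → V w p → V w′ p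

module _ (K : KripkeModel) where
  open KripkeModel K

  _⊩_ : Fin size → Formula → Set
  w ⊩ var p   = V w p
  w ⊩ ⊥'      = Empty
  w ⊩ (A ∧ B) = (w ⊩ A) × (w ⊩ B)
  w ⊩ (A ∨ B) = (w ⊩ A) ⊎ (w ⊩ B)
  w ⊩ (A ⊃ B) = ∀ w′ → w ≤ w′ → w′ ⊩ A → w′ ⊩ B

IPL : Formula → Set₁
IPL A = (K : KripkeModel) → _⊩_ K (KripkeModel.r K) A

-- Every derivable sequent is turned into a finite Kripke countermodel by recursion on its
-- derivation. For Γ ⇒ C this is a rooted model whose root forces Γ but not C. For Σ;Θ → C it
-- is a model forcing Σ ∪ Θ everywhere, such that C fails at every world R lying below a copy of
-- it inside a larger model, provided only atoms of Σ ∪ Θ hold at R and the members of Σ smaller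
-- than C are forced at R. A join rule places a new root, making true exactly the atoms of Γ,
-- below the disjoint union of the premises' models. By (J2) every implication Y ⊃ Z in some Σⱼ
-- has Y = Aᵢ for a premise i; as Aᵢ is smaller than Y ⊃ Z, induction on size shows that the
-- root refutes every Aᵢ, hence forces these implications and is admissible for every premise.

module Submission where

open import Defs
open import Data.Empty using (⊥-elim) renaming (⊥ to Empty)
open import Data.Fin using (Fin; zero; suc; _≟_)
open import Data.Fin.Properties using (0↔⊥; 1↔⊤; +↔⊎)
open import Data.Nat using (ℕ; zero; suc; _+_; _≤_; _<_; s≤s)
open import Data.Nat.Induction using (<-wellFounded)
open import Data.Nat.Properties using (m≤m+n; m≤n+m; ≤-refl; <⇒≤; ≤-trans; <-trans; ≤-<-trans)
open import Data.Product using (∃-syntax; _×_; _,_; proj₁; proj₂)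
open import Data.Sum using (_⊎_; inj₁; inj₂; [_,_]′; map₁; map₂)
open import Data.Sum.Function.Propositional using (_⊎-↔_)
open import Data.Sum.Relation.Binary.LeftOrder using (_⊎-<_; ₁∼₂; ₁∼₁; ₂∼₂; ⊎-<-refl; ⊎-<-transitive; ⊎-<-antisymmetric)
open import Data.Sum.Relation.Binary.Pointwise using (Pointwise; inj₁; inj₂; ⊎-refl; ⊎-transitive; ⊎-antisymmetric; Pointwise-≡⇒≡)
open import Data.Unit using (⊤; tt)
open import Function using (id; _∘_)
open import Function.Bundles using (_↔_; Inverse)
open import Function.Properties.Inverse using (↔-trans)
open import Induction.WellFounded using (Acc; acc)
open import Relation.Binary.PropositionalEquality using (_≡_; refl; sym; trans; cong; subst; isEquivalence)
open import Relation.Nullary using (¬_; yes; no)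
open import Relation.Unary using (_⊆_; _∉_)

record Model : Set₁ where
  field
    W         : Set
    card      : ℕ
    enum      : Fin card ↔ W
    _≼_       : W → W → Set
    ≼-refl    : ∀ {w} → w ≼ w
    ≼-trans   : ∀ {u v w} → u ≼ v → v ≼ w → u ≼ w
    ≼-antisym : ∀ {u v} → u ≼ v → v ≼ u → u ≡ v
    V         : W → ℕ → Set
    V-mono    : ∀ {w w′} p → w ≼ w′ → V w p → V w′ p

open Model using (W; V)

infix 4 _∥_≼_ _∥_⊩_

_∥_≼_ : (M : Model) → W M → W M → Set
_∥_≼_ = Model._≼_

_∥_⊩_ : (M : Model) → W M → Formula → Set
M ∥ w ⊩ var p   = V M w p
M ∥ w ⊩ ⊥'      = Empty
M ∥ w ⊩ (A ∧ B) = M ∥ w ⊩ A × M ∥ w ⊩ B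
M ∥ w ⊩ (A ∨ B) = M ∥ w ⊩ A ⊎ M ∥ w ⊩ B
M ∥ w ⊩ (A ⊃ B) = ∀ w′ → M ∥ w ≼ w′ → M ∥ w′ ⊩ A → M ∥ w′ ⊩ B

⊩-mono : ∀ (M : Model) {w w′} X → M ∥ w ≼ w′ → M ∥ w ⊩ X → M ∥ w′ ⊩ X
⊩-mono M (var p) w≼w′ = Model.V-mono M p w≼w′
⊩-mono M ⊥'      w≼w′ = id
⊩-mono M (A ∧ B) w≼w′ (a , b) = ⊩-mono M A w≼w′ a , ⊩-mono M B w≼w′ b
⊩-mono M (A ∨ B) w≼w′ (inj₁ a) = inj₁ (⊩-mono M A w≼w′ a)
⊩-mono M (A ∨ B) w≼w′ (inj₂ b) = inj₂ (⊩-mono M B w≼w′ b)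
⊩-mono M (A ⊃ B) w≼w′ h u w′≼u = h u (Model.≼-trans M w≼w′ w′≼u)

var⊥-unforced : ∀ {M w F} → IsVar⊥ F → (∀ {p} → F ≡ var p → ¬ V M w p) → ¬ M ∥ w ⊩ F
var⊥-unforced (inj₁ (p , refl)) ¬p = ¬p refl
var⊥-unforced (inj₂ refl)       _  = id

var⊥-not-imp : ∀ {F} → IsVar⊥ F → ¬ IsImp F
var⊥-not-imp (inj₁ (_ , refl)) (_ , _ , ())
var⊥-not-imp (inj₂ refl)       (_ , _ , ())

record Embedding (M N : Model) : Set where
  field
    map     : W M → W N
    forces⇒ : ∀ {w} X → M ∥ w ⊩ X → N ∥ map w ⊩ X
    forces⇐ : ∀ {w} X → N ∥ map w ⊩ X → M ∥ w ⊩ X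

open Embedding

_∘ₑ_ : ∀ {L M N} → Embedding M N → Embedding L M → Embedding L N
e ∘ₑ f = record
  { map     = map e ∘ map f
  ; forces⇒ = λ X → forces⇒ e X ∘ forces⇒ f X
  ; forces⇐ = λ X → forces⇐ f X ∘ forces⇐ e X
  }

record BoundedMorphism (M N : Model) : Set where
  field
    fun      : W M → W N
    fun-mono : ∀ {w w′} → M ∥ w ≼ w′ → N ∥ fun w ≼ fun w′
    fun-back : ∀ {w u} → N ∥ fun w ≼ u → ∃[ w′ ] M ∥ w ≼ w′ × u ≡ fun w′
    V⇒       : ∀ {w} p → V M w p → V N (fun w) p
    V⇐       : ∀ {w} p → V N (fun w) p → V M w p

boundedMorphism⇒embedding : ∀ {M N} → BoundedMorphism M N → Embedding M N
boundedMorphism⇒embedding {M} {N} b = record { map = fun ; forces⇒ = preserves ; forces⇐ = reflects }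
  where
  open BoundedMorphism b

  mutual
    preserves : ∀ {w} X → M ∥ w ⊩ X → N ∥ fun w ⊩ X
    preserves (var p) = V⇒ p
    preserves ⊥'      = id
    preserves (A ∧ B) (a , b) = preserves A a , preserves B b
    preserves (A ∨ B) (inj₁ a) = inj₁ (preserves A a)
    preserves (A ∨ B) (inj₂ b) = inj₂ (preserves B b)
    preserves (A ⊃ B) h u fw≼u u⊩A with fun-back fw≼u
    ... | w′ , w≼w′ , refl = preserves B (h w′ w≼w′ (reflects A u⊩A))

    reflects : ∀ {w} X → N ∥ fun w ⊩ X → M ∥ w ⊩ X
    reflects (var p) = V⇐ p
    reflects ⊥'      = id
    reflects (A ∧ B) (a , b) = reflects A a , reflects B b
    reflects (A ∨ B) (inj₁ a) = inj₁ (reflects A a)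
    reflects (A ∨ B) (inj₂ b) = inj₂ (reflects B b)
    reflects (A ⊃ B) h w′ w≼w′ w′⊩A = reflects B (h (fun w′) (fun-mono w≼w′) (preserves A w′⊩A))

emptyModel : Model
emptyModel = record
  { W = Empty ; card = 0 ; enum = 0↔⊥
  ; _≼_ = λ () ; ≼-refl = λ { {()} } ; ≼-trans = λ { {()} } ; ≼-antisym = λ { {()} }
  ; V = λ () ; V-mono = λ { {()} } }

module NewRoot (M : Model) (ν : ℕ → Set) (ν-below : ∀ {p} → ν p → ∀ w → V M w p) where
  open Model M using (card; enum; _≼_; ≼-refl; ≼-trans; ≼-antisym; V-mono)

  val : ⊤ ⊎ W M → ℕ → Set
  val (inj₁ _) = ν
  val (inj₂ w) = V M w

  model : Model
  model = record
    { W         = ⊤ ⊎ W M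
    ; card      = suc card
    ; enum      = ↔-trans +↔⊎ (1↔⊤ ⊎-↔ enum)
    ; _≼_       = _≡_ ⊎-< _≼_
    ; ≼-refl    = ⊎-<-refl refl ≼-refl
    ; ≼-trans   = ⊎-<-transitive trans ≼-trans
    ; ≼-antisym = λ x≼y y≼x → Pointwise-≡⇒≡ (⊎-<-antisymmetric (λ e _ → e) ≼-antisym x≼y y≼x)
    ; V         = val
    ; V-mono    = λ { p ₁∼₂ νp → ν-below νp _ ; p (₁∼₁ refl) νp → νp ; p (₂∼₂ w≼w′) → V-mono p w≼w′ }
    }

  ρ : ⊤ ⊎ W M
  ρ = inj₁ tt

  ρ-least : ∀ x → model ∥ ρ ≼ x
  ρ-least (inj₁ tt) = ₁∼₁ refl
  ρ-least (inj₂ _)  = ₁∼₂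

  old : Embedding M model
  old = boundedMorphism⇒embedding record
    { fun = inj₂ ; fun-mono = ₂∼₂ ; fun-back = λ { (₂∼₂ w≼w′) → _ , w≼w′ , refl }
    ; V⇒ = λ _ → id ; V⇐ = λ _ → id }

  ρ-forces-⊃ : ∀ {Y Z} → ¬ model ∥ ρ ⊩ Y → (∀ w → M ∥ w ⊩ (Y ⊃ Z)) → model ∥ ρ ⊩ (Y ⊃ Z)
  ρ-forces-⊃ ¬Y _ (inj₁ tt) _ Y = ⊥-elim (¬Y Y)
  ρ-forces-⊃ {Y} {Z} _ Y⊃Z (inj₂ w) _ = forces⇒ old (Y ⊃ Z) (Y⊃Z w) (inj₂ w) (₂∼₂ ≼-refl)

module _ (M₁ M₂ : Model) where
  private
    module M₁ = Model M₁
    module M₂ = Model M₂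

  _⊕_ : Model
  _⊕_ = record
    { W         = M₁.W ⊎ M₂.W
    ; card      = M₁.card + M₂.card
    ; enum      = ↔-trans +↔⊎ (M₁.enum ⊎-↔ M₂.enum)
    ; _≼_       = Pointwise M₁._≼_ M₂._≼_
    ; ≼-refl    = ⊎-refl M₁.≼-refl M₂.≼-refl
    ; ≼-trans   = ⊎-transitive M₁.≼-trans M₂.≼-trans
    ; ≼-antisym = λ x≼y y≼x → Pointwise-≡⇒≡ (⊎-antisymmetric M₁.≼-antisym M₂.≼-antisym x≼y y≼x)
    ; V         = [ M₁.V , M₂.V ]′
    ; V-mono    = λ { p (inj₁ w≼w′) → M₁.V-mono p w≼w′ ; p (inj₂ w≼w′) → M₂.V-mono p w≼w′ }
    }

  inj₁ₑ : Embedding M₁ _⊕_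
  inj₁ₑ = boundedMorphism⇒embedding record
    { fun = inj₁ ; fun-mono = inj₁ ; fun-back = λ { (inj₁ w≼w′) → _ , w≼w′ , refl }
    ; V⇒ = λ _ → id ; V⇐ = λ _ → id }

  inj₂ₑ : Embedding M₂ _⊕_
  inj₂ₑ = boundedMorphism⇒embedding record
    { fun = inj₂ ; fun-mono = inj₂ ; fun-back = λ { (inj₂ w≼w′) → _ , w≼w′ , refl }
    ; V⇒ = λ _ → id ; V⇐ = λ _ → id }

  ⊕-forces : ∀ X → (∀ w → M₁ ∥ w ⊩ X) → (∀ w → M₂ ∥ w ⊩ X) → ∀ x → _⊕_ ∥ x ⊩ X
  ⊕-forces X h₁ h₂ (inj₁ w) = forces⇒ inj₁ₑ X (h₁ w)
  ⊕-forces X h₁ h₂ (inj₂ w) = forces⇒ inj₂ₑ X (h₂ w)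

⨁ : ∀ {n} → (Fin n → Model) → Model
⨁ {zero}  _  = emptyModel
⨁ {suc n} Ms = Ms zero ⊕ ⨁ (Ms ∘ suc)

⨁-embedding : ∀ {n} (Ms : Fin n → Model) j → Embedding (Ms j) (⨁ Ms)
⨁-embedding Ms zero    = inj₁ₑ (Ms zero) (⨁ (Ms ∘ suc))
⨁-embedding Ms (suc j) = inj₂ₑ (Ms zero) (⨁ (Ms ∘ suc)) ∘ₑ ⨁-embedding (Ms ∘ suc) j

⨁-forces : ∀ {n} (Ms : Fin n → Model) X → (∀ j w → Ms j ∥ w ⊩ X) → ∀ x → ⨁ Ms ∥ x ⊩ X
⨁-forces {zero}  Ms X h ()
⨁-forces {suc n} Ms X h = ⊕-forces (Ms zero) (⨁ (Ms ∘ suc)) X (h zero) (⨁-forces (Ms ∘ suc) X (h ∘ suc))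

module _ (M : Model) (ρ : W M) (ρ-least : ∀ w → M ∥ ρ ≼ w) where
  open Model M using (card; enum; _≼_; ≼-refl; ≼-trans; ≼-antisym; V-mono)
  open Inverse enum using () renaming (to to world; from to index; strictlyInverseˡ to world∘index; strictlyInverseʳ to index∘world)

  kripke : KripkeModel
  kripke = record
    { size    = card
    ; _≤_     = λ i j → world i ≼ world j
    ; isPO    = record
      { isPreorder = record { isEquivalence = isEquivalence ; reflexive = λ { refl → ≼-refl } ; trans = ≼-trans }
      ; antisym    = λ {i} {j} i≤j j≤i →
          trans (sym (index∘world i)) (trans (cong index (≼-antisym i≤j j≤i)) (index∘world j))
      }
    ; r       = index ρ
    ; r-least = λ i → subst (_≼ world i) (sym (world∘index ρ)) (ρ-least (world i))
    ; V       = V M ∘ world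
    ; V-mono  = V-mono
    }

  mutual
    ⊩⇒forced : ∀ i X → _⊩_ kripke i X → M ∥ world i ⊩ X
    ⊩⇒forced i (var p) = id
    ⊩⇒forced i ⊥'      = id
    ⊩⇒forced i (A ∧ B) (a , b) = ⊩⇒forced i A a , ⊩⇒forced i B b
    ⊩⇒forced i (A ∨ B) (inj₁ a) = inj₁ (⊩⇒forced i A a)
    ⊩⇒forced i (A ∨ B) (inj₂ b) = inj₂ (⊩⇒forced i B b)
    ⊩⇒forced i (A ⊃ B) h w i≼w w⊩A with index w | world∘index w
    ... | j | refl = ⊩⇒forced j B (h j i≼w (forced⇒⊩ j A w⊩A))

    forced⇒⊩ : ∀ i X → M ∥ world i ⊩ X → _⊩_ kripke i X
    forced⇒⊩ i (var p) = id
    forced⇒⊩ i ⊥'      = id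
    forced⇒⊩ i (A ∧ B) (a , b) = forced⇒⊩ i A a , forced⇒⊩ i B b
    forced⇒⊩ i (A ∨ B) (inj₁ a) = inj₁ (forced⇒⊩ i A a)
    forced⇒⊩ i (A ∨ B) (inj₂ b) = inj₂ (forced⇒⊩ i B b)
    forced⇒⊩ i (A ⊃ B) h j i≤j j⊩A = forced⇒⊩ j B (h (world j) i≤j (⊩⇒forced j A j⊩A))

  refuted⇒∉IPL : ∀ {X} → ¬ M ∥ ρ ⊩ X → ¬ IPL X
  refuted⇒∉IPL {X} ρ⊮X ipl = ρ⊮X (subst (λ w → M ∥ w ⊩ X) (world∘index ρ) (⊩⇒forced (index ρ) X (ipl kripke)))

size : Formula → ℕ
size (var _) = 1
size ⊥'      = 1
size (A ∧ B) = suc (size A + size B)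
size (A ∨ B) = suc (size A + size B)
size (A ⊃ B) = suc (size A + size B)

m<1+m+n : ∀ m n → m < suc (m + n)
m<1+m+n m n = s≤s (m≤m+n m n)

n<1+m+n : ∀ m n → n < suc (m + n)
n<1+m+n m n = s≤s (m≤n+m n m)

tighten-bound : ∀ {M w} {S : FSet} {a b} → (∀ {X} → S X → size X ≤ b → M ∥ w ⊩ X) → a < b →
                ∀ {X} → S X → size X ≤ a → M ∥ w ⊩ X
tighten-bound h a<b s ≤a = h s (≤-trans ≤a (<⇒≤ a<b))

Cl-forced-bounded : ∀ {M w S A} → Cl S A → (∀ {X} → S X → size X ≤ size A → M ∥ w ⊩ X) → M ∥ w ⊩ A
Cl-forced-bounded (base X∈S)    h = h X∈S ≤-refl
Cl-forced-bounded (cl∧ cX cY)   h = Cl-forced-bounded cX (tighten-bound h (m<1+m+n _ _)) ,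
                                    Cl-forced-bounded cY (tighten-bound h (n<1+m+n _ _))
Cl-forced-bounded (cl∨ˡ _ cX)   h = inj₂ (Cl-forced-bounded cX (tighten-bound h (n<1+m+n _ _)))
Cl-forced-bounded (cl∨ʳ _ cX)   h = inj₁ (Cl-forced-bounded cX (tighten-bound h (m<1+m+n _ _)))
Cl-forced-bounded {M} (cl⊃ {X} _ cX) h w′ w≼w′ _ =
  ⊩-mono M X w≼w′ (Cl-forced-bounded cX (tighten-bound h (n<1+m+n _ _)))

Cl-forced : ∀ {M w S A} → Cl S A → (∀ {X} → S X → M ∥ w ⊩ X) → M ∥ w ⊩ A
Cl-forced c h = Cl-forced-bounded c (λ s _ → h s)

record RegCountermodel (Γ : FSet) (C : Formula) : Set₁ where
  field
    model     : Model
    ρ         : W model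
    ρ-least   : ∀ w → model ∥ ρ ≼ w
    ρ-forces  : ∀ {X} → Γ X → model ∥ ρ ⊩ X
    ρ-refutes : ¬ model ∥ ρ ⊩ C

record Admissible {M N : Model} (e : Embedding M N) (R : W N) (Σ' Θ : FSet) (C : Formula) : Set where
  field
    below-image    : ∀ w → N ∥ R ≼ map e w
    atoms⊆         : ∀ {p} → V N R p → (Σ' ∪' Θ) (var p)
    small-Σ-forced : ∀ {X} → Σ' X → size X < size C → N ∥ R ⊩ X

record IrrCountermodel (Σ' Θ : FSet) (C : Formula) : Set₁ where
  field
    model   : Model
    forces  : ∀ w {X} → (Σ' ∪' Θ) X → model ∥ w ⊩ X
    refutes : ∀ {N} (e : Embedding model N) {R} → Admissible e R Σ' Θ C → ¬ N ∥ R ⊩ C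

admissible-premise : ∀ {M N} {e : Embedding M N} {R Σ' Θ C Σ₀ Θ₀ C₀} →
                     Admissible e R Σ' Θ C → (Σ' ∪' Θ) ⊆ (Σ₀ ∪' Θ₀) → Σ₀ ⊆ Σ' → size C₀ < size C →
                     Admissible e R Σ₀ Θ₀ C₀
admissible-premise adm ⊆Σ₀∪Θ₀ Σ₀⊆Σ' C₀<C = record
  { below-image    = below-image
  ; atoms⊆         = ⊆Σ₀∪Θ₀ ∘ atoms⊆
  ; small-Σ-forced = λ σ X<C₀ → small-Σ-forced (Σ₀⊆Σ' σ) (<-trans X<C₀ C₀<C)
  }
  where open Admissible adm

admissible-∘ : ∀ {L M N} {e : Embedding M N} {R Σ' Θ C} (f : Embedding L M) →
               Admissible e R Σ' Θ C → Admissible (e ∘ₑ f) R Σ' Θ C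
admissible-∘ f adm = record
  { below-image    = below-image ∘ map f
  ; atoms⊆         = atoms⊆
  ; small-Σ-forced = small-Σ-forced
  }
  where open Admissible adm

reg-refutes-stronger : ∀ {Γ C C′} → (∀ {M w} → M ∥ w ⊩ C′ → M ∥ w ⊩ C) →
                       RegCountermodel Γ C → RegCountermodel Γ C′
reg-refutes-stronger C′⇒C c = record
  { model = model ; ρ = ρ ; ρ-least = ρ-least ; ρ-forces = ρ-forces ; ρ-refutes = ρ-refutes ∘ C′⇒C }
  where open RegCountermodel c

reg-⊃ : ∀ {Γ A B} → RegCountermodel Γ B → Cl Γ A → RegCountermodel Γ (A ⊃ B)
reg-⊃ c A∈Cl = record
  { model = model ; ρ = ρ ; ρ-least = ρ-least ; ρ-forces = ρ-forces
  ; ρ-refutes = λ A⊃B → ρ-refutes (A⊃B ρ (Model.≼-refl model) (Cl-forced A∈Cl ρ-forces))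
  }
  where open RegCountermodel c

reg-atomic : ∀ {Γ F} → Γ ⊆ IsVar → IsVar⊥ F → F ∉ Γ → RegCountermodel Γ F
reg-atomic {Γ} Γ⊆IsVar F∈V⊥ F∉Γ = record
  { model     = model
  ; ρ         = ρ
  ; ρ-least   = ρ-least
  ; ρ-forces  = forces
  ; ρ-refutes = var⊥-unforced F∈V⊥ λ { refl → F∉Γ }
  }
  where
  open NewRoot emptyModel (λ p → Γ (var p)) (λ _ ())

  forces : ∀ {X} → Γ X → model ∥ ρ ⊩ X
  forces g with Γ⊆IsVar g
  ... | _ , refl = g

irr-from-premise : ∀ {Σ₀ Θ₀ C₀ Σ' Θ C} → IrrCountermodel Σ₀ Θ₀ C₀ →
                   (Σ' ∪' Θ) ⊆ (Σ₀ ∪' Θ₀) → Σ₀ ⊆ Σ' → size C₀ < size C →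
                   (∀ {N R} → (∀ {X} → Σ' X → size X < size C → N ∥ R ⊩ X) → N ∥ R ⊩ C → N ∥ R ⊩ C₀) →
                   IrrCountermodel Σ' Θ C
irr-from-premise c ⊆Σ₀∪Θ₀ Σ₀⊆Σ' C₀<C C⇒C₀ = record
  { model   = model
  ; forces  = λ w → forces w ∘ ⊆Σ₀∪Θ₀
  ; refutes = λ e adm → refutes e (admissible-premise adm ⊆Σ₀∪Θ₀ Σ₀⊆Σ' C₀<C) ∘ C⇒C₀ (Admissible.small-Σ-forced adm)
  }
  where open IrrCountermodel c

irr-⊃∈ : ∀ {Σ₀ Θ₀ S Σ' Θ A B} → IrrCountermodel Σ₀ Θ₀ B →
         (Σ' ∪' Θ) ⊆ (Σ₀ ∪' Θ₀) → Σ₀ ⊆ Σ' → S ⊆ Σ' → Cl S A →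
         IrrCountermodel Σ' Θ (A ⊃ B)
irr-⊃∈ {A = A} {B} c ⊆Σ₀∪Θ₀ Σ₀⊆Σ' S⊆Σ' A∈Cl =
  irr-from-premise c ⊆Σ₀∪Θ₀ Σ₀⊆Σ' (n<1+m+n (size A) (size B)) λ {N} {R} small A⊃B →
    A⊃B R (Model.≼-refl N) (Cl-forced-bounded A∈Cl λ s ≤A →
      small (S⊆Σ' s) (≤-<-trans ≤A (m<1+m+n (size A) (size B))))

irr-∨ : ∀ {Σ₁ Θ₁ C₁ Σ₂ Θ₂ C₂ Σ' Θ} → IrrCountermodel Σ₁ Θ₁ C₁ → IrrCountermodel Σ₂ Θ₂ C₂ →
        (Σ' ∪' Θ) ⊆ (Σ₁ ∪' Θ₁) → (Σ' ∪' Θ) ⊆ (Σ₂ ∪' Θ₂) → Σ₁ ⊆ Σ' → Σ₂ ⊆ Σ' →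
        IrrCountermodel Σ' Θ (C₁ ∨ C₂)
irr-∨ {C₁ = C₁} {C₂ = C₂} {Σ'} {Θ} c₁ c₂ ⊆Σ₁∪Θ₁ ⊆Σ₂∪Θ₂ Σ₁⊆Σ' Σ₂⊆Σ' =
  record { model = M₁ ⊕ M₂ ; forces = forces ; refutes = refutes }
  where
  module c₁ = IrrCountermodel c₁
  module c₂ = IrrCountermodel c₂

  M₁ M₂ : Model
  M₁ = c₁.model
  M₂ = c₂.model

  forces : ∀ w {X} → (Σ' ∪' Θ) X → (M₁ ⊕ M₂) ∥ w ⊩ X
  forces (inj₁ w) {X} x = forces⇒ (inj₁ₑ M₁ M₂) X (c₁.forces w (⊆Σ₁∪Θ₁ x))
  forces (inj₂ w) {X} x = forces⇒ (inj₂ₑ M₁ M₂) X (c₂.forces w (⊆Σ₂∪Θ₂ x))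

  refutes : ∀ {N} (e : Embedding (M₁ ⊕ M₂) N) {R} → Admissible e R Σ' Θ (C₁ ∨ C₂) → ¬ N ∥ R ⊩ (C₁ ∨ C₂)
  refutes e adm (inj₁ c) = c₁.refutes (e ∘ₑ inj₁ₑ M₁ M₂)
    (admissible-∘ (inj₁ₑ M₁ M₂) (admissible-premise adm ⊆Σ₁∪Θ₁ Σ₁⊆Σ' (m<1+m+n (size C₁) (size C₂)))) c
  refutes e adm (inj₂ c) = c₂.refutes (e ∘ₑ inj₂ₑ M₁ M₂)
    (admissible-∘ (inj₂ₑ M₁ M₂) (admissible-premise adm ⊆Σ₂∪Θ₂ Σ₂⊆Σ' (n<1+m+n (size C₁) (size C₂)))) c

irr-⊃∉ : ∀ {Γ Σ' Θ A B} → RegCountermodel Γ B → (Σ' ∪' Θ) ⊆ Cl Γ → Cl Γ A → IrrCountermodel Σ' Θ (A ⊃ B)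
irr-⊃∉ {A = A} {B} c ⊆ClΓ A∈Cl = record
  { model   = model
  ; forces  = λ w x → Cl-forced (⊆ClΓ x) λ {X} g → ⊩-mono model X (ρ-least w) (ρ-forces g)
  ; refutes = λ e adm A⊃B →
      ρ-refutes (forces⇐ e B (A⊃B (map e ρ) (Admissible.below-image adm ρ) (forces⇒ e A (Cl-forced A∈Cl ρ-forces))))
  }
  where open RegCountermodel c

irr-atomic : ∀ {Σ' Θ F} → IsVar⊥ F → F ∉ (Σ' ∪' Θ) → IrrCountermodel Σ' Θ F
irr-atomic F∈V⊥ F∉ = record
  { model   = emptyModel
  ; forces  = λ ()
  ; refutes = λ e adm → var⊥-unforced F∈V⊥ λ { refl → F∉ ∘ Admissible.atoms⊆ adm }
  }

module Soundness (G : Formula) where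
  open FRJ G

  Γbar⊆IsVar∪IsImp : Γbar ⊆ IsVar ∪' IsImp
  Γbar⊆IsVar∪IsImp (inj₁ (_ , v)) = inj₁ v
  Γbar⊆IsVar∪IsImp (inj₂ (_ , i)) = inj₂ i

  Irr⇒Σ⊆Γbar : ∀ {Σ' Θ C} → Irr Σ' Θ C → Σ' ⊆ Γbar
  Irr⇒Σ⊆Γbar (ax→ _ _ Σ⊆ _ _ _) = Σ⊆
  Irr⇒Σ⊆Γbar (∧₁→ _ Σ⊆ _ _) = Σ⊆
  Irr⇒Σ⊆Γbar (∧₂→ _ Σ⊆ _ _) = Σ⊆
  Irr⇒Σ⊆Γbar (∨→ _ Σ⊆ _ _ _ _ _ _ _) = Σ⊆
  Irr⇒Σ⊆Γbar (⊃∈→ _ Σ⊆ _ _ _ _ _ _) = Σ⊆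
  Irr⇒Σ⊆Γbar (⊃∉→ _ Σ⊆ _ _ _ _ _ _) = Σ⊆

  module JoinCountermodel {m} (Σs Θs : Fin (suc m) → FSet) (As : Fin (suc m) → Formula)
    (prems : ∀ j → IrrCountermodel (Σs j) (Θs j) (As j))
    (Σs⊆IsVar∪IsImp : ∀ j → Σs j ⊆ IsVar ∪' IsImp)
    (j1 : Join.J1 Σs Θs As) (j2 : Join.J2 Σs Θs As) {Γ : FSet}
    (Γ⊆ : Γ ⊆ Join.ΣAt Σs Θs As ∪' Join.ΘAt Σs Θs As ∪' Join.Σ⊃ Σs Θs As ∪' Join.Θ⊃ Σs Θs As)
    (ΣAt⊆Γ : Join.ΣAt Σs Θs As ⊆ Γ) where

    open Join Σs Θs As

    in-every-premise : ∀ {X} → ∃[ i ] Σs i X → ∀ k → (Σs k ∪' Θs k) X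
    in-every-premise (i , σ) k with i ≟ k
    ... | yes refl = inj₁ σ
    ... | no i≢k   = j1 i k i≢k σ

    Γ-atom-in-every-premise : ∀ {p} → Γ (var p) → ∀ k → (Σs k ∪' Θs k) (var p)
    Γ-atom-in-every-premise g k with Γ⊆ g
    ... | inj₁ (inj₁ (inj₁ (_ , σ))) = in-every-premise σ k
    ... | inj₁ (inj₁ (inj₂ (_ , θ))) = inj₂ (θ k)
    ... | inj₁ (inj₂ ((_ , _ , ()) , _))
    ... | inj₂ (_ , _ , () , _)

    Ms : Fin (suc m) → Model
    Ms j = IrrCountermodel.model (prems j)

    forced-in-union : ∀ {X} → (∀ k → (Σs k ∪' Θs k) X) → ∀ x → ⨁ Ms ∥ x ⊩ X
    forced-in-union {X} h = ⨁-forces Ms X λ k w → IrrCountermodel.forces (prems k) w (h k)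

    open NewRoot (⨁ Ms) (λ p → Γ (var p)) (λ g → forced-in-union (Γ-atom-in-every-premise g))

    ρ-forces-⊃ᵢ : ∀ {i Z} → ¬ model ∥ ρ ⊩ As i → (∀ k → (Σs k ∪' Θs k) (As i ⊃ Z)) → model ∥ ρ ⊩ (As i ⊃ Z)
    ρ-forces-⊃ᵢ {i} {Z} ¬Aᵢ h = ρ-forces-⊃ {As i} {Z} ¬Aᵢ (forced-in-union h)

    refutes : ∀ j → Acc _<_ (size (As j)) → ¬ model ∥ ρ ⊩ As j
    refutes j (acc smaller) = IrrCountermodel.refutes (prems j) (old ∘ₑ ⨁-embedding Ms j) admissible
      where
      small-Σ-forced : ∀ {X} → Σs j X → size X < size (As j) → model ∥ ρ ⊩ X
      small-Σ-forced σ X<Aⱼ with Σs⊆IsVar∪IsImp j σ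
      ... | inj₁ (p , refl) = ΣAt⊆Γ ((p , refl) , j , σ)
      ... | inj₂ (Y , Z , refl) with j2 Y Z ((Y , Z , refl) , j , σ)
      ...   | i , refl = ρ-forces-⊃ᵢ (refutes i (smaller (<-trans (m<1+m+n (size (As i)) (size Z)) X<Aⱼ)))
                                     (in-every-premise (j , σ))

      admissible : Admissible (old ∘ₑ ⨁-embedding Ms j) ρ (Σs j) (Θs j) (As j)
      admissible = record
        { below-image    = λ _ → ₁∼₂
        ; atoms⊆         = λ g → Γ-atom-in-every-premise g j
        ; small-Σ-forced = small-Σ-forced
        }

    ρ-refutes-premise : ∀ j → ¬ model ∥ ρ ⊩ As j
    ρ-refutes-premise j = refutes j (<-wellFounded _)

    ρ-forces-Σ⊃ : ∀ {X} → Σ⊃ X → model ∥ ρ ⊩ X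
    ρ-forces-Σ⊃ ((Y , Z , refl) , σ) with j2 Y Z ((Y , Z , refl) , σ)
    ... | i , refl = ρ-forces-⊃ᵢ (ρ-refutes-premise i) (in-every-premise σ)

    ρ-forces-Θ⊃ : ∀ {X} → Θ⊃ X → model ∥ ρ ⊩ X
    ρ-forces-Θ⊃ (_ , _ , refl , θ , i , refl) = ρ-forces-⊃ᵢ (ρ-refutes-premise i) (λ k → inj₂ (θ k))

    ρ-forces-Γ : ∀ {X} → Γ X → model ∥ ρ ⊩ X
    ρ-forces-Γ g with Γ⊆ g
    ... | inj₁ (inj₁ (inj₁ ((_ , refl) , _))) = g
    ... | inj₁ (inj₁ (inj₂ ((_ , refl) , _))) = g
    ... | inj₁ (inj₂ σ⊃)                      = ρ-forces-Σ⊃ σ⊃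
    ... | inj₂ θ⊃                             = ρ-forces-Θ⊃ θ⊃

    countermodel : ∀ {C} → ¬ model ∥ ρ ⊩ C → RegCountermodel Γ C
    countermodel ρ⊮C = record
      { model = model ; ρ = ρ ; ρ-least = ρ-least ; ρ-forces = ρ-forces-Γ ; ρ-refutes = ρ⊮C }

  mutual
    Reg⇒countermodel : ∀ {Γ C} → Reg Γ C → RegCountermodel Γ C
    Reg⇒countermodel (ax⇒ F∈V⊥ _ _ Γ≐) =
      reg-atomic (λ g → proj₂ (proj₁ (proj₁ Γ≐ g))) F∈V⊥ (λ g → proj₂ (proj₁ Γ≐ g) refl)
    Reg⇒countermodel (∧₁⇒ _ _ d) = reg-refutes-stronger proj₁ (Reg⇒countermodel d)
    Reg⇒countermodel (∧₂⇒ _ _ d) = reg-refutes-stronger proj₂ (Reg⇒countermodel d)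
    Reg⇒countermodel (⊃∈⇒ _ _ d A∈Cl) = reg-⊃ (Reg⇒countermodel d) A∈Cl
    Reg⇒countermodel {Γ} {F} (⋈At Σs Θs As prems j1 j2 F∈V⊥ F∉ΣAt _ _ Γ≐) =
      J.countermodel (var⊥-unforced F∈V⊥ λ { refl → F∉Γ })
      where
      module J = JoinCountermodel Σs Θs As (λ j → Irr⇒countermodel (prems j))
                   (λ j → Γbar⊆IsVar∪IsImp ∘ Irr⇒Σ⊆Γbar (prems j)) j1 j2
                   (map₁ (map₁ (map₂ proj₁)) ∘ proj₁ Γ≐) (λ σ → proj₂ Γ≐ (inj₁ (inj₁ (inj₁ σ))))

      F∉Γ : F ∉ Γ
      F∉Γ g with proj₁ Γ≐ g
      ... | inj₁ (inj₁ (inj₁ σ))        = F∉ΣAt σ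
      ... | inj₁ (inj₁ (inj₂ (_ , F≢F))) = F≢F refl
      ... | inj₁ (inj₂ (F∈ℒ⊃ , _))       = var⊥-not-imp F∈V⊥ F∈ℒ⊃
      ... | inj₂ (Y , Z , F≡Y⊃Z , _)     = var⊥-not-imp F∈V⊥ (Y , Z , F≡Y⊃Z)
    Reg⇒countermodel (⋈∨ Σs Θs As prems j1 j2 (i₁ , refl) (i₂ , refl) _ _ Γ≐) =
      J.countermodel [ J.ρ-refutes-premise i₁ , J.ρ-refutes-premise i₂ ]′
      where
      module J = JoinCountermodel Σs Θs As (λ j → Irr⇒countermodel (prems j))
                   (λ j → Γbar⊆IsVar∪IsImp ∘ Irr⇒Σ⊆Γbar (prems j)) j1 j2
                   (proj₁ Γ≐) (λ σ → proj₂ Γ≐ (inj₁ (inj₁ (inj₁ σ))))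

    Irr⇒countermodel : ∀ {Σ' Θ C} → Irr Σ' Θ C → IrrCountermodel Σ' Θ C
    Irr⇒countermodel {Σ'} {Θ} (ax→ {F} F∈V⊥ _ _ _ Σ≐∅ Θ≐) = irr-atomic F∈V⊥ F∉
      where
      F∉ : F ∉ (Σ' ∪' Θ)
      F∉ (inj₁ σ) = proj₁ Σ≐∅ σ
      F∉ (inj₂ θ) with proj₁ Θ≐ θ
      ... | inj₁ (_ , F≢F)  = F≢F refl
      ... | inj₂ (_ , F∈ℒ⊃) = var⊥-not-imp F∈V⊥ F∈ℒ⊃
    Irr⇒countermodel (∧₁→ {A₁} {A₂} _ _ _ d) =
      irr-from-premise (Irr⇒countermodel d) id id (m<1+m+n (size A₁) (size A₂)) (λ _ → proj₁)
    Irr⇒countermodel (∧₂→ {A₁} {A₂} _ _ _ d) =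
      irr-from-premise (Irr⇒countermodel d) id id (n<1+m+n (size A₁) (size A₂)) (λ _ → proj₂)
    Irr⇒countermodel {Σ'} {Θ} (∨→ {Σ₁} {Θ₁} {Σ₂} {Θ₂} _ _ _ d₁ d₂ Σ₁⊆ Σ₂⊆ Σ≐ Θ≐) =
      irr-∨ (Irr⇒countermodel d₁) (Irr⇒countermodel d₂) ⊆Σ₁∪Θ₁ ⊆Σ₂∪Θ₂
            (λ σ → proj₂ Σ≐ (inj₁ σ)) (λ σ → proj₂ Σ≐ (inj₂ σ))
      where
      ⊆Σ₁∪Θ₁ : (Σ' ∪' Θ) ⊆ (Σ₁ ∪' Θ₁)
      ⊆Σ₁∪Θ₁ (inj₁ σ) = [ inj₁ , Σ₂⊆ ]′ (proj₁ Σ≐ σ)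
      ⊆Σ₁∪Θ₁ (inj₂ θ) = inj₂ (proj₁ (proj₁ Θ≐ θ))

      ⊆Σ₂∪Θ₂ : (Σ' ∪' Θ) ⊆ (Σ₂ ∪' Θ₂)
      ⊆Σ₂∪Θ₂ (inj₁ σ) = [ Σ₁⊆ , inj₁ ]′ (proj₁ Σ≐ σ)
      ⊆Σ₂∪Θ₂ (inj₂ θ) = inj₂ (proj₂ (proj₁ Θ≐ θ))
    Irr⇒countermodel {Σ'} {Θ} (⊃∈→ {Σ₀} {Ξ} _ _ _ d Ξ≐ _ Σ≐ A∈Cl) =
      irr-⊃∈ (Irr⇒countermodel d) ⊆Σ₀∪Ξ (λ σ → proj₂ Σ≐ (inj₁ σ)) (proj₂ Σ≐) A∈Cl
      where
      ⊆Σ₀∪Ξ : (Σ' ∪' Θ) ⊆ (Σ₀ ∪' Ξ)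
      ⊆Σ₀∪Ξ (inj₁ σ) = map₂ (λ λ′ → proj₂ Ξ≐ (inj₂ λ′)) (proj₁ Σ≐ σ)
      ⊆Σ₀∪Ξ (inj₂ θ) = inj₂ (proj₂ Ξ≐ (inj₁ θ))
    Irr⇒countermodel (⊃∉→ _ _ _ d Σ≐∅ Θ⊆ A∈Cl _) =
      irr-⊃∉ (Reg⇒countermodel d) (λ { (inj₁ σ) → ⊥-elim (proj₁ Σ≐∅ σ) ; (inj₂ θ) → proj₁ (Θ⊆ θ) }) A∈Cl

theorem3p1 : (G : Formula) → Provable G → ¬ IPL G
theorem3p1 G (_ , d) = refuted⇒∉IPL model ρ ρ-least {G} ρ-refutes
  where open RegCountermodel (Soundness.Reg⇒countermodel G d)
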